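{- Let $X$ be a finite set, $H$ a graph on $X$, and $\mathcal{P}^{(0)}$ a partition of $X$ (with a designated leader in each part). Let $\mathcal{P}^{(h)}$ be the partition obtained after $h\ge 1$ rounds of leader compression on $\mathcal{P}^{(0)}$ with respect to $H$. Then $\mathcal{P}^{(0)}\oplus H\sqsubseteq\mathcal{P}^{(h)}\sqsubseteq\mathcal{P}^{(0)}$; that is, $\mathcal{P}^{(0)}$ refines $\mathcal{P}^{(h)}$, and $\mathcal{P}^{(h)}$ refines $\mathcal{P}^{(0)}\oplus H$.
   Context: A partition $\mathcal{P}$ refines $\mathcal{Q}$, written $\mathcal{P}\sqsupseteq\mathcal{Q}$ or $\mathcal{Q}\sqsubseteq\mathcal{P}$, if every part of $\mathcal{P}$ is a subset of some part of $\mathcal{Q}$. For partitions $\mathcal{P},\mathcal{Q}$, $\mathcal{P}\oplus\mathcal{Q}$ is the finest partition $\mathcal{R}$ with $\mathcal{R}\sqsubseteq\mathcal{P}$ and $\mathcal{R}\sqsubseteq\mathcal{Q}$; for a graph $H$, $\mathcal{P}\oplus H$ means $\mathcal{P}\oplus\mathcal{P}_H$, where $\mathcal{P}_H$ is the partition into connected components of $H$. One round of leader compression on a partition $\mathcal{P}$ (each part having a leader; $\ell(x)$ denotes the leader of $x$'s part) with respect to $H$: each leader draws an independent uniform bit in $\{0,1\}$ and every vertex adopts the bit of its leader; every vertex $x$ with bit $1$ sends the message $(x,\ell(x))$ to each neighbor $y$ of $x$ in $H$; every vertex $y$ with bit $0$ that received some message selects an arbitrary one $(x,\ell(x))$ and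 forwards $(x,y,\ell(x))$ to its leader $\ell(y)$; every leader $z$ with bit $0$ that received some forwarded message selects an arbitrary one $(x,y,\ell(x))$, and then $z$ and all vertices whose leader is $z$ change their leader to $\ell(x)$; the partition is updated according to the new leaders. $h$ rounds of leader compression means repeating this $h$ times, each round using the partition and leaders produced by the previous round (with fresh random bits). -}

module Defs where

open import Data.Nat using (ℕ; zero; suc)
open import Data.Fin using (Fin)
open import Data.Bool using (Bool; true; false)
open import Data.Maybe using (Maybe; just; nothing; maybe′; Is-just)
open import Data.Product using (Σ; ∃; _×_; _,_)
open import Data.Sum using (_⊎_)
open import Relation.Binary.PropositionalEquality using (_≡_)
open import Relation.Binary.Construct.Closure.ReflexiveTransitive using (Star)

Graph : ℕ → Set₁
Graph n = Fin n → Fin n → Set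

-- A partition of X is given by its "same part" relation (an equivalence
-- relation).  P refines Q (written Q ⊑ P in the paper) iff every part of P
-- lies inside a part of Q, i.e. being in the same P-part implies being in the
-- same Q-part.
SamePart : ℕ → Set₁
SamePart n = Fin n → Fin n → Set

Refines : ∀ {n} → SamePart n → SamePart n → Set
Refines {n} P Q = ∀ (x y : Fin n) → P x y → Q x y

-- A partition with designated leaders: leader map ℓ, with each leader
-- being the leader of its own part.  The parts are the fibres of ℓ.
IsLeaderMap : ∀ {n} → (Fin n → Fin n) → Set
IsLeaderMap {n} ℓ = ∀ (x : Fin n) → ℓ (ℓ x) ≡ ℓ x

partOf : ∀ {n} → (Fin n → Fin n) → SamePart n
partOf ℓ x y = ℓ x ≡ ℓ y

Connected : ∀ {n} → Graph n → SamePart n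
Connected H = Star (λ x y → H x y ⊎ H y x)

-- P ⊕ Q : the finest common coarsening (join in the partition lattice),
-- i.e. the equivalence relation generated by P ∪ Q.
_⊕_ : ∀ {n} → SamePart n → SamePart n → SamePart n
(P ⊕ Q) = Star (λ x y → (P x y ⊎ P y x) ⊎ (Q x y ⊎ Q y x))

_⊕G_ : ∀ {n} → SamePart n → Graph n → SamePart n
P ⊕G H = P ⊕ Connected H

-- One round of leader compression from leader map ℓ w.r.t. H.
-- bit z : the random bit drawn by leader z (true = 1); vertex x uses bit (ℓ x).
-- recv y : the message (sender x) selected by vertex y, if any.
-- fwd z  : the forwarded message (identified by its forwarder y) selected by
--          leader z, if any.
-- All random bits and all "arbitrary" selections are quantified over.
record RoundChoice {n} (H : Graph n) (ℓ : Fin n → Fin n) : Set where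
  field
    bit  : Fin n → Bool
    recv : Fin n → Maybe (Fin n)
    fwd  : Fin n → Maybe (Fin n)
    recv-sound : ∀ y x → recv y ≡ just x →
                 bit (ℓ y) ≡ false × bit (ℓ x) ≡ true × H x y
    recv-complete : ∀ y x → bit (ℓ y) ≡ false → bit (ℓ x) ≡ true → H x y →
                    Is-just (recv y)
    fwd-sound : ∀ z y → fwd z ≡ just y →
                ℓ z ≡ z × bit z ≡ false × ℓ y ≡ z × Is-just (recv y)
    fwd-complete : ∀ z y → ℓ z ≡ z → bit z ≡ false → ℓ y ≡ z →
                   Is-just (recv y) → Is-just (fwd z)

  -- new leader of v: if ℓ v selected (x, y, ℓ x), it becomes ℓ x
  newLeader : Fin n → Fin n
  newLeader v = maybe′ (λ y → maybe′ ℓ (ℓ v) (recv y)) (ℓ v) (fwd (ℓ v))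

Round : ∀ {n} → Graph n → (Fin n → Fin n) → (Fin n → Fin n) → Set
Round {n} H ℓ ℓ' = Σ (RoundChoice H ℓ) λ c → ∀ (v : Fin n) → ℓ' v ≡ RoundChoice.newLeader c v

data Rounds {n} (H : Graph n) : ℕ → (Fin n → Fin n) → (Fin n → Fin n) → Set where
  done : ∀ {ℓ} → Rounds H zero ℓ ℓ
  step : ∀ {h ℓ ℓ₁ ℓ₂} → Round H ℓ ℓ₁ → Rounds H h ℓ₁ ℓ₂ → Rounds H (suc h) ℓ ℓ₂

-- Each round only relabels whole parts, and a part whose leader adopts a new
-- leader does so across an H-edge, so the new parts are unions of old parts
-- glued along edges of H.  Adopted leaders had bit 1 and bit-1 leaders never
-- adopt, so the new leaders are fixed points and the result is again a
-- partition with leaders; induction over the rounds finishes the argument.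
module Submission where

open import Defs
open import Data.Nat using (ℕ; _≥_)
open import Data.Fin using (Fin)
open import Data.Bool using (true)
open import Data.Maybe using (just; nothing)
open import Data.Product using (_×_; _,_; ∃₂)
open import Data.Sum using (_⊎_; inj₁; inj₂)
import Data.Sum as Sum
open import Relation.Binary using (Reflexive; Symmetric; Transitive)
open import Relation.Binary.PropositionalEquality
open import Relation.Binary.Construct.Closure.ReflexiveTransitive
  using (ε; _◅◅_; fold; reverse; return)

module _ {n : ℕ} where

  ⊕-upperˡ : {P Q : SamePart n} → Refines P (P ⊕ Q)
  ⊕-upperˡ _ _ p = return (inj₁ (inj₁ p))

  ⊕-upperʳ : {P Q : SamePart n} → Refines Q (P ⊕ Q)
  ⊕-upperʳ _ _ q = return (inj₂ (inj₁ q))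

  ⊕-sym : {P Q : SamePart n} → Symmetric (P ⊕ Q)
  ⊕-sym = reverse (Sum.map Sum.swap Sum.swap)

  ⊕-least : {P Q R : SamePart n} → Reflexive R → Symmetric R → Transitive R →
            Refines P R → Refines Q R → Refines (P ⊕ Q) R
  ⊕-least {P} {Q} {R} refl-R sym-R trans-R P⊆R Q⊆R _ _ =
    fold R (λ e r → trans-R (edge e) r) refl-R
    where
      edge : ∀ {x y} → (P x y ⊎ P y x) ⊎ (Q x y ⊎ Q y x) → R x y
      edge (inj₁ (inj₁ p)) = P⊆R _ _ p
      edge (inj₁ (inj₂ p)) = sym-R (P⊆R _ _ p)
      edge (inj₂ (inj₁ q)) = Q⊆R _ _ q
      edge (inj₂ (inj₂ q)) = sym-R (Q⊆R _ _ q)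

  ⊕-absorbˡ : {P P′ Q : SamePart n} → Refines P′ (P ⊕ Q) → Refines (P′ ⊕ Q) (P ⊕ Q)
  ⊕-absorbˡ P′⊆P⊕Q = ⊕-least ε ⊕-sym _◅◅_ P′⊆P⊕Q ⊕-upperʳ

module _ {n : ℕ} {H : Graph n} {ℓ : Fin n → Fin n} (c : RoundChoice H ℓ) where
  open RoundChoice c

  newLeader-respects-part : ∀ x y → ℓ x ≡ ℓ y → newLeader x ≡ newLeader y
  newLeader-respects-part x y ℓx≡ℓy rewrite ℓx≡ℓy = refl

  newLeader-kept-or-adopted :
    ∀ v → newLeader v ≡ ℓ v
        ⊎ ∃₂ λ x y → ℓ y ≡ ℓ v × H x y × bit (ℓ x) ≡ true × newLeader v ≡ ℓ x
  newLeader-kept-or-adopted v with fwd (ℓ v) in fwd≡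
  ... | nothing = inj₁ refl
  ... | just y with recv y in recv≡
  ...   | nothing = inj₁ refl
  ...   | just x with fwd-sound (ℓ v) y fwd≡ | recv-sound y x recv≡
  ...     | _ , _ , ℓy≡ℓv , _ | _ , bit-x , Hxy = inj₂ (x , y , ℓy≡ℓv , Hxy , bit-x , refl)

  newLeader-bit1 : ∀ v → bit (ℓ v) ≡ true → newLeader v ≡ ℓ v
  newLeader-bit1 v bit-v with fwd (ℓ v) in fwd≡
  ... | nothing = refl
  ... | just y with fwd-sound (ℓ v) y fwd≡
  ...   | _ , bit-v≡false , _ with () ← trans (sym bit-v) bit-v≡false

  module _ (L : IsLeaderMap ℓ) where

    newLeader-isLeaderMap : IsLeaderMap newLeader
    newLeader-isLeaderMap v with newLeader-kept-or-adopted v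
    ... | inj₁ kept = trans (cong newLeader kept) (newLeader-respects-part (ℓ v) v (L v))
    ... | inj₂ (x , _ , _ , _ , bit-x , adopted) = begin
      newLeader (newLeader v)  ≡⟨ cong newLeader adopted ⟩
      newLeader (ℓ x)          ≡⟨ newLeader-bit1 (ℓ x) (trans (cong bit (L x)) bit-x) ⟩
      ℓ (ℓ x)                  ≡⟨ L x ⟩
      ℓ x                      ≡⟨ sym adopted ⟩
      newLeader v              ∎
      where open ≡-Reasoning

    newLeader-within-join : ∀ v → (partOf ℓ ⊕G H) v (newLeader v)
    newLeader-within-join v with newLeader-kept-or-adopted v
    ... | inj₁ kept = ⊕-upperˡ _ _ (trans (sym (L v)) (cong ℓ (sym kept)))
    ... | inj₂ (x , y , ℓy≡ℓv , Hxy , _ , adopted) =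
      ⊕-upperˡ v y (sym ℓy≡ℓv) ◅◅ ⊕-upperʳ y x (return (inj₂ Hxy))
        ◅◅ ⊕-upperˡ x _ (trans (sym (L x)) (cong ℓ (sym adopted)))

module _ {n : ℕ} {H : Graph n} where

  round-isLeaderMap : ∀ {ℓ ℓ′} → IsLeaderMap ℓ → Round H ℓ ℓ′ → IsLeaderMap ℓ′
  round-isLeaderMap L (c , ℓ′≡) v
    rewrite ℓ′≡ v | ℓ′≡ (RoundChoice.newLeader c v) = newLeader-isLeaderMap c L v

  round-coarsens : ∀ {ℓ ℓ′} → Round H ℓ ℓ′ → Refines (partOf ℓ) (partOf ℓ′)
  round-coarsens (c , ℓ′≡) x y ℓx≡ℓy
    rewrite ℓ′≡ x | ℓ′≡ y = newLeader-respects-part c x y ℓx≡ℓy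

  round-within-join : ∀ {ℓ ℓ′} → IsLeaderMap ℓ → Round H ℓ ℓ′ →
                      Refines (partOf ℓ′) (partOf ℓ ⊕G H)
  round-within-join {ℓ} L (c , ℓ′≡) x y ℓ′x≡ℓ′y =
    subst ((partOf ℓ ⊕G H) x) (trans (sym (ℓ′≡ x)) (trans ℓ′x≡ℓ′y (ℓ′≡ y)))
          (newLeader-within-join c L x)
      ◅◅ ⊕-sym (newLeader-within-join c L y)

  rounds-coarsen : ∀ {h ℓ ℓ′} → Rounds H h ℓ ℓ′ → Refines (partOf ℓ) (partOf ℓ′)
  rounds-coarsen done          _ _ p = p
  rounds-coarsen (step r rs) x y p = rounds-coarsen rs x y (round-coarsens r x y p)

  rounds-within-join : ∀ {h ℓ ℓ′} → IsLeaderMap ℓ → Rounds H h ℓ ℓ′ →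
                       Refines (partOf ℓ′) (partOf ℓ ⊕G H)
  rounds-within-join L done          = ⊕-upperˡ
  rounds-within-join L (step r rs) x y p =
    ⊕-absorbˡ (round-within-join L r) x y
      (rounds-within-join (round-isLeaderMap L r) rs x y p)

proposition3p7 : (n : ℕ) (H : Graph n) → Symmetric H →
                 (ℓ₀ : Fin n → Fin n) → IsLeaderMap ℓ₀ →
                 (h : ℕ) → h ≥ 1 → (ℓₕ : Fin n → Fin n) → Rounds H h ℓ₀ ℓₕ →
                 Refines (partOf ℓ₀) (partOf ℓₕ) × Refines (partOf ℓₕ) (partOf ℓ₀ ⊕G H)
proposition3p7 _ _ _ _ L₀ _ _ _ rs = rounds-coarsen rs , rounds-within-join L₀ rs
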